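{- If $\Lambda$ is an orderly numerical semigroup, then $f(\Lambda) < 2m(\Lambda)$.
   Context: A numerical semigroup is a subset $\Lambda \subseteq \mathbb{N}$ containing $0$, closed under addition, with finite complement. Genus $g(\Lambda) = |\mathbb{N}\setminus\Lambda|$; multiplicity $m(\Lambda)=\min(\Lambda\setminus\{0\})$; Frobenius number $f(\Lambda)=\max(\mathbb{N}\setminus\Lambda)$ (with $f(\mathbb{N})=-1$). A minimal generator is a nonzero element of $\Lambda$ not a sum of two nonzero elements of $\Lambda$; an effective generator is a minimal generator larger than $f(\Lambda)$; $h(\Lambda)$ is the number of effective generators. $\Lambda'$ descends from $\Lambda$ if $\Lambda' = \Lambda\setminus\{\lambda\}$ for an effective generator $\lambda$ of $\Lambda$; the descent is weak if every effective generator of $\Lambda'$ is an effective generator of $\Lambda$, and strong otherwise. $\Lambda'$ is strongly descended if it is obtained from some numerical semigroup by a strong descent; by convention $\mathbb{N}$ is also strongly descended. $\Lambda$ is orderly if it is strongly descended and $g(\Lambda) < 2h(\Lambda)$. -}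

module Defs where

open import Data.Bool using (Bool; true; false; not; _∧_)
open import Data.Nat using (ℕ; zero; suc; _+_; _*_; _≤_; _<_; _≡ᵇ_)
open import Data.Integer using (ℤ; +_; -[1+_]) renaming (_<_ to _<ℤ_; _≤_ to _≤ℤ_)
open import Data.List using (List; length)
open import Data.List.Membership.Propositional using (_∈_)
open import Data.List.Relation.Unary.Unique.Propositional using (Unique)
open import Data.Product using (Σ; ∃; _×_; _,_)
open import Data.Sum using (_⊎_)
open import Relation.Binary.PropositionalEquality using (_≡_; _≢_)
open import Relation.Nullary using (¬_)
open import Function.Bundles using (_⇔_)

record NumSemigroup : Set where
  field
    mem      : ℕ → Bool
    has0     : mem 0 ≡ true
    closed   : ∀ a b → mem a ≡ true → mem b ≡ true → mem (a + b) ≡ true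
    cofinite : ∃ λ N → ∀ n → N ≤ n → mem n ≡ true
open NumSemigroup public

_∈S_ : ℕ → NumSemigroup → Set
n ∈S Λ = mem Λ n ≡ true

_∉S_ : ℕ → NumSemigroup → Set
n ∉S Λ = mem Λ n ≡ false

IsGenus : NumSemigroup → ℕ → Set
IsGenus Λ g = Σ (List ℕ) λ gaps →
  Unique gaps × (∀ n → (n ∈ gaps) ⇔ (n ∉S Λ)) × length gaps ≡ g

IsMultiplicity : NumSemigroup → ℕ → Set
IsMultiplicity Λ m = 0 < m × m ∈S Λ × (∀ k → 0 < k → k < m → k ∉S Λ)

IsFrobenius : NumSemigroup → ℤ → Set
IsFrobenius Λ f =
  (∀ n → n ∉S Λ → (+ n) ≤ℤ f) ×
  ((f ≡ -[1+ 0 ] × (∀ n → n ∈S Λ)) ⊎ (∃ λ n → f ≡ + n × n ∉S Λ))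

MinimalGenerator : NumSemigroup → ℕ → Set
MinimalGenerator Λ x = x ∈S Λ × x ≢ 0 ×
  ¬ (∃ λ a → ∃ λ b → a ≢ 0 × b ≢ 0 × a ∈S Λ × b ∈S Λ × a + b ≡ x)

EffectiveGenerator : NumSemigroup → ℕ → Set
EffectiveGenerator Λ x = MinimalGenerator Λ x ×
  (∀ f → IsFrobenius Λ f → f <ℤ (+ x))

IsH : NumSemigroup → ℕ → Set
IsH Λ h = Σ (List ℕ) λ es →
  Unique es × (∀ n → (n ∈ es) ⇔ EffectiveGenerator Λ n) × length es ≡ h

DescendsVia : NumSemigroup → NumSemigroup → ℕ → Set
DescendsVia Λ Λ' x = EffectiveGenerator Λ x ×
  (∀ n → mem Λ' n ≡ (mem Λ n ∧ not (n ≡ᵇ x)))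

WeakDescent : NumSemigroup → NumSemigroup → Set
WeakDescent Λ Λ' = ∀ n → EffectiveGenerator Λ' n → EffectiveGenerator Λ n

StronglyDescended : NumSemigroup → Set
StronglyDescended Λ' = (∀ n → n ∈S Λ') ⊎
  (∃ λ Λ → ∃ λ x → DescendsVia Λ Λ' x × ¬ WeakDescent Λ Λ')

Orderly : NumSemigroup → Set
Orderly Λ = StronglyDescended Λ ×
  (∀ g h → IsGenus Λ g → IsH Λ h → g < 2 * h)

-- If f ≥ 2m, then for every effective generator y the numbers y − m and y − 2m are gaps (m and 2m
-- lie in Λ and y is indecomposable). The first lie above f − m, the second, since y ≤ f + m, lie
-- at or below f − m, so these 2h gaps are distinct and g ≥ 2h, contradicting g < 2h. Only the
-- inequality g < 2h of orderliness is needed.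
module Submission where

open import Defs
open import Data.Nat using (ℕ; _*_)
open import Data.Integer using (ℤ; +_; _<_)

import Data.Bool as Bool
open import Data.Bool.Properties using (¬-not)
open import Data.Nat as ℕ using (suc; _+_; _∸_; _≤_; s≤s; z≤n; _≤?_; _<?_; _≟_)
open import Data.Nat.Properties
open import Data.Integer as ℤ using (-[1+_]; +<+; -<+)
open import Data.Integer.Properties using (drop‿+<+; drop‿+≤+)
open import Data.List using (List; []; _∷_; length; map; _++_; filter; upTo)
open import Data.List.Properties using (length-map; length-++; filter-notAll)
open import Data.List.Membership.Propositional using (_∈_)
open import Data.List.Membership.Propositional.Properties
  using (∈-filter⁺; ∈-filter⁻; ∈-upTo⁺; ∈-map⁻; ∈-++⁻)
import Data.List.Relation.Unary.Any as Any
open import Data.List.Relation.Unary.Any using (here; there)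
import Data.List.Relation.Unary.All as All
open import Data.List.Relation.Unary.All using (All; []; _∷_)
import Data.List.Relation.Unary.All.Properties as All
open import Data.List.Relation.Unary.AllPairs using ([]; _∷_)
open import Data.List.Relation.Unary.Unique.Propositional using (Unique)
import Data.List.Relation.Unary.Unique.Propositional.Properties as Unique
open import Data.Product using (Σ; ∃; _×_; _,_; proj₁; proj₂)
open import Data.Sum using (inj₁; inj₂)
open import Function using (_∘_)
open import Function.Bundles using (_⇔_; mk⇔; Equivalence)
open import Relation.Binary.Definitions using (DecidableEquality)
open import Relation.Binary.PropositionalEquality
open import Relation.Nullary using (¬_; yes; no; ¬?; contradiction)
open import Relation.Nullary.Decidable using (_×-dec_; map′)
open import Relation.Unary using (Pred; Decidable)

2*n≡n+n : ∀ n → 2 * n ≡ n + n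
2*n≡n+n n = cong (λ k → n + k) (+-identityʳ n)

module _ {a} {A : Set a} (_≟ᴬ_ : DecidableEquality A) where

  Unique-length-mono : ∀ {xs ys : List A} → Unique xs → (∀ {z} → z ∈ xs → z ∈ ys) →
                       length xs ≤ length ys
  Unique-length-mono {[]}     _             _     = z≤n
  Unique-length-mono {x ∷ xs} {ys} (x∉xs ∷ xs!) xs⊆ys = begin
    suc (length xs)              ≤⟨ s≤s (Unique-length-mono xs! xs⊆ys∖x) ⟩
    suc (length (filter ≢x? ys)) ≤⟨ filter-notAll ≢x? ys x∈ys ⟩
    length ys                    ∎
    where
    open ≤-Reasoning
    ≢x? : Decidable (x ≢_)
    ≢x? z = ¬? (x ≟ᴬ z)
    x∈ys : Any.Any (λ z → ¬ x ≢ z) ys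
    x∈ys = Any.map (λ x≡z x≢z → x≢z x≡z) (xs⊆ys (here refl))
    xs⊆ys∖x : ∀ {z} → z ∈ xs → z ∈ filter ≢x? ys
    xs⊆ys∖x z∈xs = ∈-filter⁺ ≢x? (xs⊆ys (there z∈xs)) (All.lookup x∉xs z∈xs)

Unique-map⁺-on : ∀ {a b p} {A : Set a} {B : Set b} {P : Pred A p} {f : A → B} →
                 (∀ {x y} → P x → P y → f x ≡ f y → x ≡ y) →
                 ∀ {xs} → All P xs → Unique xs → Unique (map f xs)
Unique-map⁺-on inj []         []           = []
Unique-map⁺-on inj (px ∷ pxs) (x∉xs ∷ xs!) =
  All.map⁺ (All.zipWith (λ (py , x≢y) → x≢y ∘ inj px py) (pxs , x∉xs)) ∷ Unique-map⁺-on inj pxs xs!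

Counted : ∀ {p} → Pred ℕ p → ℕ → Set p
Counted P c = Σ (List ℕ) λ xs → Unique xs × (∀ n → (n ∈ xs) ⇔ P n) × length xs ≡ c

count-bounded : ∀ {p} {P : Pred ℕ p} → Decidable P → ∀ b → (∀ {n} → P n → n ℕ.< b) → ∃ (Counted P)
count-bounded P? b bound =
  _ , filter P? (upTo b) , Unique.filter⁺ P? (Unique.upTo⁺ b) ,
  (λ n → mk⇔ (proj₂ ∘ ∈-filter⁻ P? {xs = upTo b}) (λ pn → ∈-filter⁺ P? (∈-upTo⁺ (bound pn)) pn)) ,
  refl

module _ (Λ : NumSemigroup) where

  member? : Decidable (_∈S Λ)
  member? n = mem Λ n Bool.≟ Bool.true

  gap? : Decidable (_∉S Λ)
  gap? n = mem Λ n Bool.≟ Bool.false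

  ¬∈S⇒∉S : ∀ {n} → ¬ n ∈S Λ → n ∉S Λ
  ¬∈S⇒∉S = ¬-not

  ∉S⇒¬∈S : ∀ {n} → n ∉S Λ → ¬ n ∈S Λ
  ∉S⇒¬∈S n∉ n∈ with () ← trans (sym n∈) n∉

  genus-exists : ∃ (IsGenus Λ)
  genus-exists = count-bounded gap? N gap<N
    where
    N = proj₁ (cofinite Λ)
    gap<N : ∀ {n} → n ∉S Λ → n ℕ.< N
    gap<N {n} n∉ with n <? N
    ... | yes n<N = n<N
    ... | no  n≮N = contradiction (proj₂ (cofinite Λ) n (≮⇒≥ n≮N)) (∉S⇒¬∈S n∉)

  Decomposable : ℕ → Set
  Decomposable x = ∃ λ a → ∃ λ b → a ≢ 0 × b ≢ 0 × a ∈S Λ × b ∈S Λ × a + b ≡ x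

  decomposable? : Decidable Decomposable
  decomposable? x = map′ to from (anyUpTo? splitsAt? x)
    where
    SplitsAt : ℕ → Set
    SplitsAt a = a ≢ 0 × x ∸ a ≢ 0 × a ∈S Λ × (x ∸ a) ∈S Λ
    splitsAt? : Decidable SplitsAt
    splitsAt? a = ¬? (a ≟ 0) ×-dec ¬? (x ∸ a ≟ 0) ×-dec member? a ×-dec member? (x ∸ a)
    to : (∃ λ a → a ℕ.< x × SplitsAt a) → Decomposable x
    to (a , a<x , a≢0 , b≢0 , a∈ , b∈) = a , x ∸ a , a≢0 , b≢0 , a∈ , b∈ , m+[n∸m]≡n (<⇒≤ a<x)
    from : Decomposable x → ∃ λ a → a ℕ.< x × SplitsAt a
    from (a , b , a≢0 , b≢0 , a∈ , b∈ , refl) =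
      a , m<m+n a (n≢0⇒n>0 b≢0) , a≢0 , subst (_≢ 0) b≡a+b∸a b≢0 , a∈ , subst (_∈S Λ) b≡a+b∸a b∈
      where b≡a+b∸a = sym (m+n∸m≡n a b)

  minimalGenerator? : Decidable (MinimalGenerator Λ)
  minimalGenerator? x = member? x ×-dec ¬? (x ≟ 0) ×-dec ¬? (decomposable? x)

  minimalGenerator-∸ : ∀ {x a} → MinimalGenerator Λ x → a ∈S Λ → 0 ℕ.< a → a ℕ.< x →
                       ¬ (x ∸ a) ∈S Λ
  minimalGenerator-∸ {x} {a} (_ , _ , indecomposable) a∈ 0<a a<x x∸a∈ =
    indecomposable (a , x ∸ a , n>0⇒n≢0 0<a , n>0⇒n≢0 (m<n⇒0<n∸m a<x) , a∈ , x∸a∈ ,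
                    m+[n∸m]≡n (<⇒≤ a<x))

  -- If x > F + a, then x − a > F lies in Λ and x = a + (x − a) decomposes.
  minimalGenerator-≤ : ∀ {F a x} → (∀ {n} → F ℕ.< n → n ∈S Λ) → a ∈S Λ → 0 ℕ.< a →
                       MinimalGenerator Λ x → x ≤ F + a
  minimalGenerator-≤ {F} {a} {x} above a∈ 0<a gen with x ≤? F + a
  ... | yes x≤F+a = x≤F+a
  ... | no  x≰F+a = contradiction (above F<x∸a) (minimalGenerator-∸ gen a∈ 0<a a<x)
    where
    F+a<x = ≰⇒> x≰F+a
    a<x   = ≤-<-trans (m≤n+m a F) F+a<x
    F<x∸a : F ℕ.< x ∸ a
    F<x∸a = subst (ℕ._< x ∸ a) (m+n∸n≡m F a) (∸-monoˡ-< F+a<x (m≤n+m a F))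

module _ (Λ : NumSemigroup) {F : ℕ} (frob : IsFrobenius Λ (+ F)) where

  gap-≤-frobenius : ∀ {n} → n ∉S Λ → n ≤ F
  gap-≤-frobenius n∉ = drop‿+≤+ (proj₁ frob _ n∉)

  >frobenius⇒∈S : ∀ {n} → F ℕ.< n → n ∈S Λ
  >frobenius⇒∈S {n} F<n with member? Λ n
  ... | yes n∈ = n∈
  ... | no  n∉ = contradiction (gap-≤-frobenius (¬∈S⇒∉S Λ n∉)) (<⇒≱ F<n)

  effectiveGenerator⇔ : ∀ {x} → EffectiveGenerator Λ x ⇔ (MinimalGenerator Λ x × F ℕ.< x)
  effectiveGenerator⇔ {x} = mk⇔ (λ (gen , >f) → gen , drop‿+<+ (>f (+ F) frob))
                                (λ (gen , F<x) → gen , frobenius<x F<x)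
    where
    frobenius<x : F ℕ.< x → ∀ f → IsFrobenius Λ f → f ℤ.< + x
    frobenius<x _   _ (_ , inj₁ (refl , _))        = -<+
    frobenius<x F<x _ (_ , inj₂ (F′ , refl , F′∉)) = +<+ (≤-<-trans (gap-≤-frobenius F′∉) F<x)

  h-exists : ∃ (IsH Λ)
  h-exists = count-bounded effectiveGenerator? (suc (F + suc F)) (s≤s ∘ effectiveGenerator-≤)
    where
    effectiveGenerator? : Decidable (EffectiveGenerator Λ)
    effectiveGenerator? x = map′ from to (minimalGenerator? Λ x ×-dec F <? x)
      where open Equivalence effectiveGenerator⇔
    effectiveGenerator-≤ : ∀ {x} → EffectiveGenerator Λ x → x ≤ F + suc F
    effectiveGenerator-≤ = minimalGenerator-≤ Λ >frobenius⇒∈S (>frobenius⇒∈S ≤-refl) ℕ.z<s ∘ proj₁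

module _ (Λ : NumSemigroup) {m F : ℕ} (frob : IsFrobenius Λ (+ F)) (mult : IsMultiplicity Λ m)
         (2m≤F : 2 * m ≤ F) where

  private
    0<m = proj₁ mult
    m∈  = proj₁ (proj₂ mult)

    2m∈ : (2 * m) ∈S Λ
    2m∈ = subst (_∈S Λ) (sym (2*n≡n+n m)) (closed Λ m m m∈ m∈)

    m≤2m : m ≤ 2 * m
    m≤2m = m≤m+n m (m + 0)

    m≤F : m ≤ F
    m≤F = ≤-trans m≤2m 2m≤F

    ∸2m-≤ : ∀ {y} → y ≤ F + m → y ∸ 2 * m ≤ F ∸ m
    ∸2m-≤ {y} y≤F+m = begin
      y ∸ 2 * m     ≡⟨ cong (y ∸_) (2*n≡n+n m) ⟩
      y ∸ (m + m)   ≡⟨ ∸-+-assoc y m m ⟨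
      y ∸ m ∸ m     ≤⟨ ∸-monoˡ-≤ m (∸-monoˡ-≤ m y≤F+m) ⟩
      F + m ∸ m ∸ m ≡⟨ cong (_∸ m) (m+n∸n≡m F m) ⟩
      F ∸ m         ∎
      where open ≤-Reasoning

  2*h≤g : ∀ {g h} → IsGenus Λ g → IsH Λ h → 2 * h ≤ g
  2*h≤g (gaps , _ , gaps⇔ , refl) (es , es! , es⇔ , refl) = begin
    2 * length es                                ≡⟨ 2*n≡n+n (length es) ⟩
    length es + length es                        ≡⟨ cong₂ _+_ (length-map (_∸ m) es) (length-map (_∸ 2 * m) es) ⟨
    length (shifted m) + length (shifted (2 * m)) ≡⟨ length-++ (shifted m) ⟨
    length (shifted m ++ shifted (2 * m))         ≤⟨ Unique-length-mono _≟_ shifted-unique shifted⊆gaps ⟩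
    length gaps                                  ∎
    where
    open ≤-Reasoning

    shifted : ℕ → List ℕ
    shifted k = map (_∸ k) es

    effective : ∀ {y} → y ∈ es → MinimalGenerator Λ y × F ℕ.< y
    effective {y} = Equivalence.to (effectiveGenerator⇔ Λ frob) ∘ Equivalence.to (es⇔ y)

    2m<y : ∀ {y} → y ∈ es → 2 * m ℕ.< y
    2m<y y∈ = ≤-<-trans 2m≤F (proj₂ (effective y∈))

    shiftedBy-unique : ∀ {k} → k ≤ 2 * m → Unique (shifted k)
    shiftedBy-unique k≤2m =
      Unique-map⁺-on ∸-cancelʳ-≡ (All.tabulate (λ y∈ → ≤-trans k≤2m (<⇒≤ (2m<y y∈)))) es!

    shiftedBy⊆gaps : ∀ {k z} → k ∈S Λ → 0 ℕ.< k → k ≤ 2 * m → z ∈ shifted k → z ∈ gaps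
    shiftedBy⊆gaps {k} k∈ 0<k k≤2m z∈ with y , y∈ , refl ← ∈-map⁻ (_∸ k) z∈ =
      Equivalence.from (gaps⇔ _) (¬∈S⇒∉S Λ
        (minimalGenerator-∸ Λ (proj₁ (effective y∈)) k∈ 0<k (≤-<-trans k≤2m (2m<y y∈))))

    above : ∀ {z} → z ∈ shifted m → F ∸ m ℕ.< z
    above z∈ with y , y∈ , refl ← ∈-map⁻ (_∸ m) z∈ = ∸-monoˡ-< (proj₂ (effective y∈)) m≤F

    below : ∀ {z} → z ∈ shifted (2 * m) → z ≤ F ∸ m
    below z∈ with y , y∈ , refl ← ∈-map⁻ (_∸ 2 * m) z∈ =
      ∸2m-≤ (minimalGenerator-≤ Λ (>frobenius⇒∈S Λ frob) m∈ 0<m (proj₁ (effective y∈)))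

    shifted-unique : Unique (shifted m ++ shifted (2 * m))
    shifted-unique = Unique.++⁺ (shiftedBy-unique m≤2m) (shiftedBy-unique ≤-refl)
                                (λ (z∈₁ , z∈₂) → <⇒≱ (above z∈₁) (below z∈₂))

    shifted⊆gaps : ∀ {z} → z ∈ shifted m ++ shifted (2 * m) → z ∈ gaps
    shifted⊆gaps z∈ with ∈-++⁻ (shifted m) z∈
    ... | inj₁ z∈₁ = shiftedBy⊆gaps m∈  0<m m≤2m z∈₁
    ... | inj₂ z∈₂ = shiftedBy⊆gaps 2m∈ (≤-trans 0<m m≤2m) ≤-refl z∈₂

proposition1 : (Λ : NumSemigroup) (m : ℕ) (f : ℤ) →
    Orderly Λ → IsMultiplicity Λ m → IsFrobenius Λ f → f < + (2 * m)
proposition1 Λ m .(-[1+ 0 ]) _ _ (_ , inj₁ (refl , _)) = -<+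
proposition1 Λ m .(+ F) (_ , g<2h) mult frob@(_ , inj₂ (F , refl , _)) with 2 * m ≤? F
... | no  2m≰F = +<+ (≰⇒> 2m≰F)
... | yes 2m≤F = contradiction (2*h≤g Λ frob mult 2m≤F genus count) (<⇒≱ (g<2h _ _ genus count))
  where
  genus = proj₂ (genus-exists Λ)
  count = proj₂ (h-exists Λ frob)
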